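{- Let $\lambda$ be a partition of $n$ and $\beta$ a composition of $n$, and let $m_i$ be the number of parts of $\lambda$ equal to $i$ ($1\le i\le k=\lambda_1$). Then $$\binom{\ell(\lambda)}{m_1,m_2,\dots,m_k}R_{\lambda\beta}=\sum_{\substack{\alpha\preccurlyeq\beta\\ \widetilde{\alpha}=\lambda}}|\mathrm{OSP}(\alpha,\beta)|.$$
   Context: A composition of $n$ is a sequence of positive integers summing to $n$; $\ell(\cdot)$ is the number of parts; $\widetilde{\alpha}$ is the partition from sorting the parts of $\alpha$ decreasingly. $\alpha\preccurlyeq\beta$ means $\beta$ is obtained from $\alpha$ by summing consecutive blocks of parts; $\alpha^{(i)}$ is the block of parts of $\alpha$ summing to $\beta_i$. $R_{\lambda\beta}$ is the number of ordered set partitions $(B_1,\dots,B_{\ell(\beta)})$ of $\{1,\dots,\ell(\lambda)\}$ with $\beta_j=\sum_{i\in B_j}\lambda_i$ for all $j$. For $\alpha\preccurlyeq\beta$, $\mathrm{OSP}(\alpha,\beta)$ is the set of ordered set partitions $(C_1,\dots,C_{\ell(\beta)})$ of $\{1,\dots,\ell(\alpha)\}$ with $|C_i|=\ell(\alpha^{(i)})$. -}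

module Defs where

open import Data.Nat using (ℕ; zero; suc; _≥_; _∸_; _*_; _<_)
open import Data.Nat.Properties using (_≟_; ≤-decTotalOrder)
open import Data.Nat.Combinatorics using (_C_)
open import Data.Fin using (Fin)
import Data.Fin.Properties as FinP
open import Data.List using (List; []; _∷_; length; map; filter; concatMap; upTo; allFin; concat; reverse; lookup)
open import Data.Nat.ListAction using (sum)
open import Relation.Unary using (Pred; Decidable)
open import Level using (Level)
open import Data.List.Relation.Unary.All using (All)
open import Data.List.Relation.Unary.Linked using (Linked)
open import Data.List.Sort.MergeSort ≤-decTotalOrder using (sort)
open import Relation.Binary.PropositionalEquality using (_≡_)
open import Relation.Nullary using (Dec)
open import Relation.Nullary.Decidable using (⌊_⌋)
open import Data.Bool using (if_then_else_)

count : ∀ {a p} {A : Set a} {P : Pred A p} → Decidable P → List A → ℕ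
count P? xs = length (filter P? xs)

IsComposition : ℕ → List ℕ → Set
IsComposition n β = All (0 <_) β × sum β ≡ n
  where open import Data.Product using (_×_)

IsPartition : ℕ → List ℕ → Set
IsPartition n λ′ = All (0 <_) λ′ × Linked _≥_ λ′ × sum λ′ ≡ n
  where open import Data.Product using (_×_)

sortDec : List ℕ → List ℕ
sortDec α = reverse (sort α)

listsOfLength : List ℕ → ℕ → List (List ℕ)
listsOfLength xs zero    = [] ∷ []
listsOfLength xs (suc j) = concatMap (λ x → map (x ∷_) (listsOfLength xs j)) xs

-- all compositions of n (each listed exactly once): lists of length
-- j ≤ n with parts in {1,…,n} whose sum is n
compositions : ℕ → List (List ℕ)
compositions n =
  filter (λ c → sum c ≟ n)
    (concatMap (listsOfLength (map suc (upTo n))) (upTo (suc n)))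

-- All refinements α ≼ β of β, each given by its block decomposition
-- (α^(1), …, α^(ℓ(β))) where α^(i) is a composition of β_i;
-- α itself is the concatenation of the blocks.
refinements : List ℕ → List (List (List ℕ))
refinements []      = [] ∷ []
refinements (b ∷ β) =
  concatMap (λ c → map (c ∷_) (refinements β)) (compositions b)

-- Functions Fin N → Fin k (= ordered set partitions (B_1,…,B_k) of
-- {1,…,N}, possibly with empty blocks, B_j = f⁻¹(j))

allFuns : (N k : ℕ) → List (Fin N → Fin k)
allFuns zero    k = (λ ()) ∷ []
allFuns (suc N) k =
  concatMap (λ j → map (λ f → λ { Fin.zero → j ; (Fin.suc i) → f i }) (allFuns N k))
            (allFin k)

blockSum : (λ′ : List ℕ) {k : ℕ} → (Fin (length λ′) → Fin k) → Fin k → ℕ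
blockSum λ′ f j =
  sum (map (λ i → if ⌊ f i FinP.≟ j ⌋ then lookup λ′ i else 0) (allFin (length λ′)))

blockSize : {N k : ℕ} → (Fin N → Fin k) → Fin k → ℕ
blockSize {N} f j = count (λ i → f i FinP.≟ j) (allFin N)

-- R_{λβ}: number of ordered set partitions (B_1,…,B_ℓ(β)) of {1,…,ℓ(λ)}
-- with β_j = Σ_{i ∈ B_j} λ_i for all j.  (Blocks are automatically
-- nonempty since the parts of β are positive.)
R : List ℕ → List ℕ → ℕ
R λ′ β = count (λ f → FinP.all? (λ j → lookup β j ≟ blockSum λ′ f j))
               (allFuns (length λ′) (length β))

-- |OSP(α,β)| for α = concat blocks, blocks = (α^(1),…,α^(ℓ(β))):
-- ordered set partitions (C_1,…,C_ℓ(β)) of {1,…,ℓ(α)} with |C_i| = ℓ(α^(i)).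
OSPcount : List (List ℕ) → ℕ
OSPcount blocks =
  count (λ f → FinP.all? (λ j → blockSize f j ≟ length (lookup blocks j)))
        (allFuns (length (concat blocks)) (length blocks))

multinomial : ℕ → List ℕ → ℕ
multinomial n []       = 1
multinomial n (m ∷ ms) = (n C m) * multinomial (n ∸ m) ms

headOr0 : List ℕ → ℕ
headOr0 []      = 0
headOr0 (x ∷ _) = x

multiplicities : List ℕ → List ℕ
multiplicities λ′ = map (λ i → count (λ x → x ≟ suc i) λ′) (upTo (headOr0 λ′))

rhs : List ℕ → List ℕ → ℕ
rhs λ′ β =
  sum (map OSPcount
        (filter (λ blocks → Data.List.Properties.≡-dec _≟_ (sortDec (concat blocks)) λ′)
                (refinements β)))
  where import Data.List.Properties

-- Both sides are shown to satisfy the same recursion in the number of parts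
-- of λ, obtained by removing one part v:
--  * R_{λβ} counts maps from the parts of λ to the entries of β with
--    prescribed fibre weights; it does not depend on the order of λ, and
--    sending v somewhere lowers one entry of β by v  (R-remove);
--  * (ℓ(λ); m) splits by Pascal's rule into the (ℓ(λ)−1; m − e_v)  (multL-remove);
--  * |OSP(α,β)| is the multinomial (ℓ(α); ℓ(α⁽¹⁾), …) (the unit-weight case of
--    the fibre count), and Pascal's rule removes the first part v of one block
--    of α; a refinement of β with that part removed is a refinement of β
--    with one entry lowered by v  (rhs-remove).
-- For the induction to go through, β is an arbitrary list (entries 0 allowed);
-- the statement needs only that the parts of λ are positive and decreasing.
module Submission where

open import Level using (Level)
open import Function using (_∘_)
open import Data.Empty using (⊥; ⊥-elim)
open import Data.Unit using (⊤; tt)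
open import Data.Bool using (if_then_else_)
open import Data.Product using (_×_; _,_; proj₁; proj₂; Σ; map₂)
open import Relation.Nullary using (Dec; yes; no; ¬_; does; _×-dec_)
open import Relation.Nullary.Decidable using (dec-true; dec-false; ⌊_⌋; isYes≗does)
open import Relation.Binary.PropositionalEquality
open import Data.Nat using (ℕ; zero; suc; _+_; _*_; _∸_; _≤_; _<_; _≥_; z≤n; s≤s)
open import Data.Nat.Properties
open import Data.Nat.Combinatorics using (_C_; nCn≡1; nCk+nC[k+1]≡[n+1]C[k+1])
open import Data.Nat.ListAction using (sum)
open import Data.Nat.ListAction.Properties using (sum-++)
open import Algebra.Properties.CommutativeSemigroup +-commutativeSemigroup
  using () renaming (interchange to +-interchange)
open import Algebra.Properties.CommutativeSemigroup *-commutativeSemigroup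
  using () renaming (x∙yz≈y∙xz to *-left-comm)
open import Data.Fin using (Fin; toℕ; cast) renaming (zero to fz; suc to fs)
import Data.Fin.Properties as FinP
open import Data.List
  using (List; []; _∷_; _++_; map; filter; concatMap; concat; length; upTo; applyUpTo; allFin; tabulate; lookup; reverse)
open import Data.List.Properties
  using (map-++; map-cong; map-∘; map-tabulate; tabulate-cong; map-upTo; length-++; unfold-reverse; ≡-dec)
open import Data.List.Relation.Unary.All as All using (All; []; _∷_)
import Data.List.Relation.Unary.All.Properties as All
open import Data.List.Relation.Unary.AllPairs as AllPairs using (AllPairs; []; _∷_)
import Data.List.Relation.Unary.AllPairs.Properties as AllPairs
import Data.List.Relation.Unary.Linked.Properties as Linked
open import Data.List.Relation.Unary.Any using (here; there)
open import Data.List.Membership.Propositional using (_∈_)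
open import Data.List.Membership.DecPropositional _≟_ using (_∈?_)
open import Data.List.Relation.Binary.Permutation.Propositional as ↭
  using (_↭_; ↭-refl; ↭-sym; ↭-trans; ↭-prep)
open import Data.List.Relation.Binary.Permutation.Propositional.Properties
  using (↭-reverse; All-resp-↭; Any-resp-↭; drop-∷; ↭-empty-inv; ↭-length; filter-↭; shift; ++⁺ˡ)
open import Data.List.Sort.MergeSort ≤-decTotalOrder using (sort)
open import Data.List.Sort.MergeSort.Properties ≤-decTotalOrder using (sort-↭; sort-↗)
open import Defs

private variable
  a b p q : Level
  k N : ℕ
  A : Set a
  B : Set b

∑ : List A → (A → ℕ) → ℕ
∑ xs f = sum (map f xs)

∑-++ : (xs ys : List A) (f : A → ℕ) → ∑ (xs ++ ys) f ≡ ∑ xs f + ∑ ys f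
∑-++ xs ys f = trans (cong sum (map-++ f xs ys)) (sum-++ (map f xs) (map f ys))

∑-map : (g : A → B) (xs : List A) (f : B → ℕ) → ∑ (map g xs) f ≡ ∑ xs (f ∘ g)
∑-map g xs f = cong sum (sym (map-∘ xs))

∑-concatMap : (g : A → List B) (xs : List A) (f : B → ℕ) →
  ∑ (concatMap g xs) f ≡ ∑ xs (λ x → ∑ (g x) f)
∑-concatMap g [] f = refl
∑-concatMap g (x ∷ xs) f = trans (∑-++ (g x) _ f) (cong (∑ (g x) f +_) (∑-concatMap g xs f))

∑-cong : (xs : List A) {f g : A → ℕ} → (∀ x → f x ≡ g x) → ∑ xs f ≡ ∑ xs g
∑-cong xs e = cong sum (map-cong e xs)

∑-cong-All : {P : A → Set p} (xs : List A) {f g : A → ℕ} →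
  All P xs → (∀ x → P x → f x ≡ g x) → ∑ xs f ≡ ∑ xs g
∑-cong-All [] [] e = refl
∑-cong-All (x ∷ xs) (px ∷ pxs) e = cong₂ _+_ (e x px) (∑-cong-All xs pxs e)

∑-zero : (xs : List A) (f : A → ℕ) → (∀ x → f x ≡ 0) → ∑ xs f ≡ 0
∑-zero [] f e = refl
∑-zero (x ∷ xs) f e = cong₂ _+_ (e x) (∑-zero xs f e)

∑-+ : (xs : List A) (f g : A → ℕ) → ∑ xs (λ x → f x + g x) ≡ ∑ xs f + ∑ xs g
∑-+ [] f g = refl
∑-+ (x ∷ xs) f g = trans (cong (f x + g x +_) (∑-+ xs f g)) (+-interchange (f x) (g x) _ _)

∑-*ˡ : (xs : List A) (c : ℕ) (f : A → ℕ) → ∑ xs (λ x → c * f x) ≡ c * ∑ xs f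
∑-*ˡ [] c f = sym (*-zeroʳ c)
∑-*ˡ (x ∷ xs) c f = trans (cong (c * f x +_) (∑-*ˡ xs c f)) (sym (*-distribˡ-+ c (f x) _))

∑-*ʳ : (xs : List A) (c : ℕ) (f : A → ℕ) → ∑ xs f * c ≡ ∑ xs (λ x → f x * c)
∑-*ʳ xs c f = trans (*-comm (∑ xs f) c) (trans (sym (∑-*ˡ xs c f)) (∑-cong xs (λ x → *-comm c (f x))))

∑-swap : (xs : List A) (ys : List B) (F : A → B → ℕ) →
  ∑ xs (λ x → ∑ ys (F x)) ≡ ∑ ys (λ y → ∑ xs (λ x → F x y))
∑-swap [] ys F = sym (∑-zero ys _ (λ _ → refl))
∑-swap (x ∷ xs) ys F = trans (cong (∑ ys (F x) +_) (∑-swap xs ys F)) (sym (∑-+ ys (F x) _))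

∑-allFin-suc : (k : ℕ) (f : Fin (suc k) → ℕ) → ∑ (allFin (suc k)) f ≡ f fz + ∑ (allFin k) (f ∘ fs)
∑-allFin-suc k f = cong (λ xs → f fz + sum xs)
  (trans (map-tabulate fs f) (sym (map-tabulate (λ i → i) (f ∘ fs))))

∑-upTo-suc : (n : ℕ) (f : ℕ → ℕ) → ∑ (upTo (suc n)) f ≡ f 0 + ∑ (upTo n) (f ∘ suc)
∑-upTo-suc n f = cong (f 0 +_) (trans (cong (λ xs → ∑ xs f) (sym (map-upTo suc n))) (∑-map suc (upTo n) f))

𝟙 : {P : Set p} → Dec P → ℕ
𝟙 d = if does d then 1 else 0

𝟙-yes : {P : Set p} (d : Dec P) → P → 𝟙 d ≡ 1
𝟙-yes d x = cong (λ t → if t then 1 else 0) (dec-true d x)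

𝟙-no : {P : Set p} (d : Dec P) → ¬ P → 𝟙 d ≡ 0
𝟙-no d x = cong (λ t → if t then 1 else 0) (dec-false d x)

𝟙-⇔ : {P : Set p} {Q : Set q} (d : Dec P) (e : Dec Q) → (P → Q) → (Q → P) → 𝟙 d ≡ 𝟙 e
𝟙-⇔ (yes x) e to from = sym (𝟙-yes e (to x))
𝟙-⇔ (no ¬x) e to from = sym (𝟙-no e (¬x ∘ from))

𝟙-× : {P : Set p} {Q : Set q} (d : Dec P) (e : Dec Q) → 𝟙 (d ×-dec e) ≡ 𝟙 d * 𝟙 e
𝟙-× (yes _) (yes _) = refl
𝟙-× (yes _) (no _)  = refl
𝟙-× (no _)  e       = refl

𝟙-guard : {P : Set p} (d : Dec P) {m n : ℕ} → (P → m ≡ n) → 𝟙 d * m ≡ 𝟙 d * n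
𝟙-guard (yes x) e = cong (1 *_) (e x)
𝟙-guard (no _)  e = refl

count≡∑ : {P : A → Set p} (P? : ∀ x → Dec (P x)) (xs : List A) → count P? xs ≡ ∑ xs (𝟙 ∘ P?)
count≡∑ P? [] = refl
count≡∑ P? (x ∷ xs) with P? x
... | yes _ = cong suc (count≡∑ P? xs)
... | no _  = count≡∑ P? xs

∑-filter : {P : A → Set p} (P? : ∀ x → Dec (P x)) (xs : List A) (f : A → ℕ) →
  ∑ (filter P? xs) f ≡ ∑ xs (λ x → 𝟙 (P? x) * f x)
∑-filter P? [] f = refl
∑-filter P? (x ∷ xs) f with P? x
... | yes _ = cong₂ _+_ (sym (+-identityʳ (f x))) (∑-filter P? xs f)
... | no _  = ∑-filter P? xs f

count-⇔ : {P : A → Set p} {Q : A → Set q} (P? : ∀ x → Dec (P x)) (Q? : ∀ x → Dec (Q x)) (xs : List A) →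
  (∀ x → P x → Q x) → (∀ x → Q x → P x) → count P? xs ≡ count Q? xs
count-⇔ P? Q? xs to from = trans (count≡∑ P? xs)
  (trans (∑-cong xs (λ x → 𝟙-⇔ (P? x) (Q? x) (to x) (from x))) (sym (count≡∑ Q? xs)))

fibreSum : (Fin N → Fin k) → (Fin N → ℕ) → Fin k → ℕ
fibreSum {N} f w j = sum (map (λ i → if ⌊ f i FinP.≟ j ⌋ then w i else 0) (allFin N))

fibres? : (b : Fin k → ℕ) (w : Fin N → ℕ) (f : Fin N → Fin k) → Dec (∀ j → b j ≡ fibreSum f w j)
fibres? b w f = FinP.all? (λ j → b j ≟ fibreSum f w j)

-- fibreCount w b : the number of maps f : Fin N → Fin k whose fibre over
-- every j has weight b j.  R λ β is the case w = λ, b = β, and |OSP| the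
-- case of unit weights.
fibreCount : (Fin N → ℕ) → (Fin k → ℕ) → ℕ
fibreCount {N} {k} w b = count (fibres? b w) (allFuns N k)

fibreCount-cong : (w : Fin N → ℕ) {b b′ : Fin k → ℕ} → (∀ j → b j ≡ b′ j) → fibreCount w b ≡ fibreCount w b′
fibreCount-cong {N} {k} w e = count-⇔ _ _ (allFuns N k)
  (λ f h j → trans (sym (e j)) (h j)) (λ f h j → trans (e j) (h j))

fibreCount-nil : (w : Fin 0 → ℕ) (b : Fin k → ℕ) → fibreCount w b ≡ 𝟙 (FinP.all? (λ j → b j ≟ 0))
fibreCount-nil {k} w b = trans (count≡∑ (fibres? b w) (allFuns 0 k)) (+-identityʳ _)

decreaseAt : (Fin k → ℕ) → Fin k → ℕ → Fin k → ℕ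
decreaseAt b j₀ x j = if does (j₀ FinP.≟ j) then b j ∸ x else b j

decreaseAt-same : (b : Fin k → ℕ) (j : Fin k) (x : ℕ) → decreaseAt b j x j ≡ b j ∸ x
decreaseAt-same b j x = cong (λ t → if t then b j ∸ x else b j) (dec-true (j FinP.≟ j) refl)

decreaseAt-other : (b : Fin k → ℕ) {j j′ : Fin k} (x : ℕ) → ¬ j ≡ j′ → decreaseAt b j x j′ ≡ b j′
decreaseAt-other b {j} {j′} x j≢j′ = cong (λ t → if t then b j′ ∸ x else b j′) (dec-false (j FinP.≟ j′) j≢j′)

fibreSum-cons : (g : Fin (suc N) → Fin k) (f : Fin N → Fin k) (j₀ : Fin k) (w : Fin (suc N) → ℕ) →
  g fz ≡ j₀ → (∀ i → g (fs i) ≡ f i) → (j : Fin k) →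
  fibreSum g w j ≡ (if ⌊ j₀ FinP.≟ j ⌋ then w fz else 0) + fibreSum f (w ∘ fs) j
fibreSum-cons {N} g f _ w refl g∘fs≗f j = trans (∑-allFin-suc N _) (cong (_ +_)
  (∑-cong (allFin N) (λ i → cong (λ j′ → if ⌊ j′ FinP.≟ j ⌋ then w (fs i) else 0) (g∘fs≗f i))))

peel : (b : Fin k → ℕ) (j₀ j : Fin k) {x s : ℕ} → x ≤ b j₀ →
  (b j ≡ (if ⌊ j₀ FinP.≟ j ⌋ then x else 0) + s → decreaseAt b j₀ x j ≡ s)
  × (decreaseAt b j₀ x j ≡ s → b j ≡ (if ⌊ j₀ FinP.≟ j ⌋ then x else 0) + s)
peel b j₀ j {x} {s} x≤b with j₀ FinP.≟ j
... | yes refl = (λ e → trans (cong (_∸ x) e) (m+n∸m≡n x s))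
               , (λ e → trans (sym (m+[n∸m]≡n x≤b)) (cong (x +_) e))
... | no _ = (λ e → e) , (λ e → e)

peel-feasible : (b : Fin k → ℕ) (j₀ : Fin k) {x s : ℕ} → b j₀ ≡ (if ⌊ j₀ FinP.≟ j₀ ⌋ then x else 0) + s → x ≤ b j₀
peel-feasible b j₀ {x} {s} e with j₀ FinP.≟ j₀
... | yes _  = subst (x ≤_) (sym e) (m≤m+n x s)
... | no j₀≢j₀ = ⊥-elim (j₀≢j₀ refl)

fibres-cons : (w : Fin (suc N) → ℕ) (b : Fin k → ℕ) (g : Fin (suc N) → Fin k) (f : Fin N → Fin k) (j₀ : Fin k) →
  g fz ≡ j₀ → (∀ i → g (fs i) ≡ f i) →
  𝟙 (fibres? b w g) ≡ 𝟙 (w fz ≤? b j₀) * 𝟙 (fibres? (decreaseAt b j₀ (w fz)) (w ∘ fs) f)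
fibres-cons w b g f j₀ g0 g∘fs≗f =
  trans (𝟙-⇔ (fibres? b w g) ((w fz ≤? b j₀) ×-dec fibres? b′ (w ∘ fs) f) to from)
        (𝟙-× (w fz ≤? b j₀) (fibres? b′ (w ∘ fs) f))
  where
  b′ : Fin _ → ℕ
  b′ = decreaseAt b j₀ (w fz)
  split : ∀ j → fibreSum g w j ≡ (if ⌊ j₀ FinP.≟ j ⌋ then w fz else 0) + fibreSum f (w ∘ fs) j
  split = fibreSum-cons g f j₀ w g0 g∘fs≗f
  to : (∀ j → b j ≡ fibreSum g w j) → w fz ≤ b j₀ × (∀ j → decreaseAt b j₀ (w fz) j ≡ fibreSum f (w ∘ fs) j)
  to h = fits , λ j → proj₁ (peel b j₀ j fits) (trans (h j) (split j))
    where
    fits : w fz ≤ b j₀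
    fits = peel-feasible b j₀ (trans (h j₀) (split j₀))
  from : w fz ≤ b j₀ × (∀ j → decreaseAt b j₀ (w fz) j ≡ fibreSum f (w ∘ fs) j) → ∀ j → b j ≡ fibreSum g w j
  from (fits , h) j = trans (proj₂ (peel b j₀ j fits) (h j)) (sym (split j))

fibreCount-cons : (w : Fin (suc N) → ℕ) (b : Fin k → ℕ) →
  fibreCount w b ≡ ∑ (allFin k) (λ j₀ → 𝟙 (w fz ≤? b j₀) * fibreCount (w ∘ fs) (decreaseAt b j₀ (w fz)))
fibreCount-cons {N} {k} w b =
  trans (count≡∑ (fibres? b w) (allFuns (suc N) k))
  (trans (∑-concatMap _ (allFin k) _)
  (∑-cong (allFin k) λ j₀ →
    trans (∑-map _ (allFuns N k) _)
    (trans (∑-cong (allFuns N k) (λ f → fibres-cons w b _ f j₀ refl (λ _ → refl)))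
    (trans (∑-*ˡ (allFuns N k) (𝟙 (w fz ≤? b j₀)) (𝟙 ∘ fibres? (decreaseAt b j₀ (w fz)) (w ∘ fs)))
    (cong (𝟙 (w fz ≤? b j₀) *_) (sym (count≡∑ (fibres? (decreaseAt b j₀ (w fz)) (w ∘ fs)) (allFuns N k))))))))

Rvec : List ℕ → (Fin k → ℕ) → ℕ
Rvec w b = fibreCount (lookup w) b

Rvec-cons : (x : ℕ) (w : List ℕ) (b : Fin k → ℕ) →
  Rvec (x ∷ w) b ≡ ∑ (allFin k) (λ j → 𝟙 (x ≤? b j) * Rvec w (decreaseAt b j x))
Rvec-cons x w b = fibreCount-cons (lookup (x ∷ w)) b

Rvec-cong : (w : List ℕ) {b b′ : Fin k → ℕ} → (∀ j → b j ≡ b′ j) → Rvec w b ≡ Rvec w b′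
Rvec-cong w = fibreCount-cong (lookup w)

decreaseAt-comm : (b : Fin k → ℕ) (j j′ : Fin k) (x y : ℕ) (i : Fin k) →
  decreaseAt (decreaseAt b j x) j′ y i ≡ decreaseAt (decreaseAt b j′ y) j x i
decreaseAt-comm b j j′ x y i with j FinP.≟ i | j′ FinP.≟ i
... | yes _ | yes _ = trans (∸-+-assoc (b i) x y) (trans (cong (b i ∸_) (+-comm x y)) (sym (∸-+-assoc (b i) y x)))
... | yes _ | no _  = refl
... | no _  | yes _ = refl
... | no _  | no _  = refl

decrease-twice : (b : Fin k → ℕ) (j j′ : Fin k) {x y : ℕ} →
  x ≤ b j × y ≤ decreaseAt b j x j′ → y ≤ b j′ × x ≤ decreaseAt b j′ y j
decrease-twice b j j′ {x} {y} (x≤ , y≤) with j FinP.≟ j′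
... | yes refl = m+n≤o⇒m≤o y y+x≤b
               , subst (x ≤_) (sym (decreaseAt-same b j y)) (m+n≤o⇒m≤o∸n x (subst (_≤ b j) (+-comm y x) y+x≤b))
  where
  y+x≤b : y + x ≤ b j
  y+x≤b = m≤o∸n⇒m+n≤o y x≤ y≤
... | no j≢j′ = y≤
              , subst (x ≤_) (sym (decreaseAt-other b y (j≢j′ ∘ sym))) x≤

placeTwo : ℕ → ℕ → List ℕ → (Fin k → ℕ) → Fin k → Fin k → ℕ
placeTwo x y w b j j′ = 𝟙 (x ≤? b j) * 𝟙 (y ≤? decreaseAt b j x j′) * Rvec w (decreaseAt (decreaseAt b j x) j′ y)

Rvec-cons₂ : (x y : ℕ) (w : List ℕ) (b : Fin k → ℕ) →
  Rvec (x ∷ y ∷ w) b ≡ ∑ (allFin k) (λ j → ∑ (allFin k) (placeTwo x y w b j))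
Rvec-cons₂ {k} x y w b = trans (Rvec-cons x (y ∷ w) b) (∑-cong (allFin k) λ j →
  trans (cong (𝟙 (x ≤? b j) *_) (Rvec-cons y w (decreaseAt b j x)))
  (trans (sym (∑-*ˡ (allFin k) (𝟙 (x ≤? b j)) _))
  (∑-cong (allFin k) λ j′ → sym (*-assoc (𝟙 (x ≤? b j)) _ _))))

placeTwo-swap : (x y : ℕ) (w w′ : List ℕ) → (∀ {k} (b : Fin k → ℕ) → Rvec w b ≡ Rvec w′ b) →
  (b : Fin k → ℕ) (j j′ : Fin k) → placeTwo x y w b j j′ ≡ placeTwo y x w′ b j′ j
placeTwo-swap x y w w′ w≈w′ b j j′ = cong₂ _*_
  (trans (sym (𝟙-× (x ≤? b j) (y ≤? decreaseAt b j x j′)))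
  (trans (𝟙-⇔ ((x ≤? b j) ×-dec (y ≤? decreaseAt b j x j′)) ((y ≤? b j′) ×-dec (x ≤? decreaseAt b j′ y j))
               (decrease-twice b j j′) (decrease-twice b j′ j))
         (𝟙-× (y ≤? b j′) (x ≤? decreaseAt b j′ y j))))
  (trans (w≈w′ _) (Rvec-cong w′ (decreaseAt-comm b j j′ x y)))

Rvec-perm : {w w′ : List ℕ} → w ↭ w′ → (b : Fin k → ℕ) → Rvec w b ≡ Rvec w′ b
Rvec-perm ↭.refl b = refl
Rvec-perm {k} {x ∷ w} {.x ∷ w′} (↭.prep x p) b = trans (Rvec-cons x w b)
  (trans (∑-cong (allFin k) (λ j → cong (𝟙 (x ≤? b j) *_) (Rvec-perm p (decreaseAt b j x))))
  (sym (Rvec-cons x w′ b)))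
Rvec-perm {k} {x ∷ y ∷ w} {.y ∷ .x ∷ w′} (↭.swap x y p) b =
  trans (Rvec-cons₂ x y w b)
  (trans (∑-cong (allFin k) (λ j → ∑-cong (allFin k) (placeTwo-swap x y w w′ (Rvec-perm p) b j)))
  (trans (∑-swap (allFin k) (allFin k) (λ j j′ → placeTwo y x w′ b j′ j))
  (sym (Rvec-cons₂ y x w′ b))))
Rvec-perm (↭.trans p q) b = trans (Rvec-perm p b) (Rvec-perm q b)

decrements : List ℕ → List (List ℕ)
decrements []           = []
decrements (zero ∷ ms)  = map (zero ∷_) (decrements ms)
decrements (suc m ∷ ms) = (m ∷ ms) ∷ map (suc m ∷_) (decrements ms)

decrements-zeros : (ms : List ℕ) → sum ms ≡ 0 → decrements ms ≡ []
decrements-zeros []          e = refl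
decrements-zeros (zero ∷ ms) e = cong (map (zero ∷_)) (decrements-zeros ms e)

multinomial-zeros : (n : ℕ) (ms : List ℕ) → sum ms ≡ 0 → multinomial n ms ≡ 1
multinomial-zeros n []          e = refl
multinomial-zeros n (zero ∷ ms) e = trans (+-identityʳ _) (multinomial-zeros n ms e)

-- Pascal's rule for multinomial coefficients: classify the arrangements of
-- suc n objects by the class of the first one
multinomial-pascal : (ms : List ℕ) (n : ℕ) → sum ms ≡ suc n →
  multinomial (suc n) ms ≡ ∑ (decrements ms) (multinomial n)
multinomial-pascal (zero ∷ ms) n e = trans (+-identityʳ _) (trans (multinomial-pascal ms n e)
  (sym (trans (∑-map (zero ∷_) (decrements ms) (multinomial n)) (∑-cong (decrements ms) (λ _ → +-identityʳ _)))))
multinomial-pascal (suc m ∷ ms) n e with sum ms in sum-ms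
... | zero = begin
  (suc n C suc m) * multinomial (n ∸ m) ms   ≡⟨ cong (λ z → (suc z C suc m) * multinomial (z ∸ m) ms) n≡m ⟩
  (suc m C suc m) * multinomial (m ∸ m) ms   ≡⟨ cong (_* multinomial (m ∸ m) ms) (trans (nCn≡1 (suc m)) (sym (nCn≡1 m))) ⟩
  (m C m) * multinomial (m ∸ m) ms           ≡⟨ cong (λ z → (z C m) * multinomial (z ∸ m) ms) (sym n≡m) ⟩
  (n C m) * multinomial (n ∸ m) ms           ≡⟨ sym (+-identityʳ _) ⟩
  (n C m) * multinomial (n ∸ m) ms + ∑ (map (suc m ∷_) []) (multinomial n)
    ≡⟨ cong (λ ds → (n C m) * multinomial (n ∸ m) ms + ∑ (map (suc m ∷_) ds) (multinomial n)) (sym (decrements-zeros ms sum-ms)) ⟩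
  ∑ (decrements (suc m ∷ ms)) (multinomial n) ∎
  where
  open ≡-Reasoning
  n≡m : n ≡ m
  n≡m = suc-injective (trans (sym e) (+-identityʳ (suc m)))
... | suc S = begin
  (suc n C suc m) * multinomial (n ∸ m) ms
    ≡⟨ cong₂ (λ c r → c * multinomial r ms) (sym (nCk+nC[k+1]≡[n+1]C[k+1] n m)) n∸m ⟩
  ((n C m) + (n C suc m)) * multinomial (suc S) ms
    ≡⟨ *-distribʳ-+ (multinomial (suc S) ms) (n C m) (n C suc m) ⟩
  (n C m) * multinomial (suc S) ms + (n C suc m) * multinomial (suc S) ms
    ≡⟨ cong₂ _+_ (cong (λ r → (n C m) * multinomial r ms) (sym n∸m)) (cong ((n C suc m) *_) (multinomial-pascal ms S sum-ms)) ⟩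
  (n C m) * multinomial (n ∸ m) ms + (n C suc m) * ∑ (decrements ms) (multinomial S)
    ≡⟨ cong ((n C m) * multinomial (n ∸ m) ms +_) (sym (∑-*ˡ (decrements ms) (n C suc m) (multinomial S))) ⟩
  (n C m) * multinomial (n ∸ m) ms + ∑ (decrements ms) (λ ms′ → (n C suc m) * multinomial S ms′)
    ≡⟨ cong ((n C m) * multinomial (n ∸ m) ms +_) (sym (trans (∑-map (suc m ∷_) (decrements ms) (multinomial n))
         (∑-cong (decrements ms) (λ ms′ → cong (λ r → (n C suc m) * multinomial r ms′) n∸sm)))) ⟩
  ∑ (decrements (suc m ∷ ms)) (multinomial n) ∎
  where
  open ≡-Reasoning
  n≡m+sS : n ≡ m + suc S
  n≡m+sS = suc-injective (sym e)
  n∸m : n ∸ m ≡ suc S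
  n∸m = trans (cong (_∸ m) n≡m+sS) (m+n∸m≡n m (suc S))
  n∸sm : n ∸ suc m ≡ S
  n∸sm = trans (cong (_∸ suc m) (trans n≡m+sS (+-suc m S))) (m+n∸m≡n m S)

∑-decrements-tabulate : (s : Fin k → ℕ) (h : List ℕ → ℕ) →
  ∑ (decrements (tabulate s)) h ≡ ∑ (allFin k) (λ j → 𝟙 (1 ≤? s j) * h (tabulate (decreaseAt s j 1)))
∑-decrements-tabulate {zero} s h = refl
∑-decrements-tabulate {suc k} s h = trans split-head (sym (∑-allFin-suc k F))
  where
  F : Fin (suc k) → ℕ
  F j = 𝟙 (1 ≤? s j) * h (tabulate (decreaseAt s j 1))
  split-head : ∑ (decrements (tabulate s)) h ≡ F fz + ∑ (allFin k) (F ∘ fs)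
  split-head with s fz
  ... | zero = trans (∑-map (zero ∷_) (decrements (tabulate (s ∘ fs))) h)
    (∑-decrements-tabulate (s ∘ fs) (h ∘ (zero ∷_)))
  ... | suc m = cong₂ _+_ (sym (+-identityʳ _))
    (trans (∑-map (suc m ∷_) (decrements (tabulate (s ∘ fs))) h) (∑-decrements-tabulate (s ∘ fs) (h ∘ (suc m ∷_))))

sum-decreaseAt : (s : Fin k → ℕ) (j : Fin k) → 1 ≤ s j → suc (sum (tabulate (decreaseAt s j 1))) ≡ sum (tabulate s)
sum-decreaseAt {suc k} s fz 1≤s = cong (_+ sum (tabulate (s ∘ fs))) (trans (+-comm 1 (s fz ∸ 1)) (m∸n+n≡m 1≤s))
sum-decreaseAt {suc k} s (fs j) 1≤s = trans (sym (+-suc (s fz) _)) (cong (s fz +_) (sum-decreaseAt (s ∘ fs) j 1≤s))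

sum-tabulate-zero : (s : Fin k → ℕ) → sum (tabulate s) ≡ 0 → ∀ j → s j ≡ 0
sum-tabulate-zero s e fz = m+n≡0⇒m≡0 (s fz) e
sum-tabulate-zero s e (fs j) = sum-tabulate-zero (s ∘ fs) (m+n≡0⇒n≡0 (s fz) e) j

unitFibreCount : (N : ℕ) (s : Fin k → ℕ) → sum (tabulate s) ≡ N → fibreCount {N} (λ _ → 1) s ≡ multinomial N (tabulate s)
unitFibreCount zero s e = trans (fibreCount-nil (λ _ → 1) s)
  (trans (𝟙-yes (FinP.all? (λ j → s j ≟ 0)) (sum-tabulate-zero s e)) (sym (multinomial-zeros 0 (tabulate s) e)))
unitFibreCount {k} (suc N) s e =
  trans (fibreCount-cons (λ _ → 1) s)
  (trans (∑-cong (allFin k) (λ j → 𝟙-guard (1 ≤? s j) (λ 1≤s →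
           unitFibreCount N (decreaseAt s j 1) (suc-injective (trans (sum-decreaseAt s j 1≤s) e)))))
  (trans (sym (∑-decrements-tabulate s (multinomial N))) (sym (multinomial-pascal (tabulate s) N e))))

blockSize≡fibreSum : (f : Fin N → Fin k) (j : Fin k) → blockSize f j ≡ fibreSum f (λ _ → 1) j
blockSize≡fibreSum {N} f j = trans (count≡∑ (λ i → f i FinP.≟ j) (allFin N))
  (∑-cong (allFin N) (λ i → cong (λ t → if t then 1 else 0) (sym (isYes≗does (f i FinP.≟ j)))))

tabulate-lengths : (bl : List (List ℕ)) → tabulate (λ j → length (lookup bl j)) ≡ map length bl
tabulate-lengths []       = refl
tabulate-lengths (c ∷ bl) = cong (length c ∷_) (tabulate-lengths bl)

sum-lengths : (bl : List (List ℕ)) → sum (map length bl) ≡ length (concat bl)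
sum-lengths []       = refl
sum-lengths (c ∷ bl) = trans (cong (length c +_) (sum-lengths bl)) (sym (length-++ c))

OSPcount-closed : (bl : List (List ℕ)) → OSPcount bl ≡ multinomial (length (concat bl)) (map length bl)
OSPcount-closed bl =
  trans (count-⇔ _ (fibres? sizes (λ _ → 1)) (allFuns ℓα (length bl))
          (λ f h j → trans (sym (h j)) (blockSize≡fibreSum f j))
          (λ f h j → trans (blockSize≡fibreSum f j) (sym (h j))))
  (trans (unitFibreCount ℓα sizes (trans (cong sum (tabulate-lengths bl)) (sum-lengths bl)))
         (cong (multinomial ℓα) (tabulate-lengths bl)))
  where
  ℓα : ℕ
  ℓα = length (concat bl)
  sizes : Fin (length bl) → ℕ
  sizes j = length (lookup bl j)

oneTo : ℕ → List ℕ
oneTo b = map suc (upTo b)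

∑-upTo-cong : (n : ℕ) {f g : ℕ → ℕ} → (∀ i → i < n → f i ≡ g i) → ∑ (upTo n) f ≡ ∑ (upTo n) g
∑-upTo-cong zero    e = refl
∑-upTo-cong (suc n) e = trans (∑-upTo-suc n _)
  (trans (cong₂ _+_ (e 0 (s≤s z≤n)) (∑-upTo-cong n (λ i i<n → e (suc i) (s≤s i<n)))) (sym (∑-upTo-suc n _)))

∑-upTo-truncate : (m n : ℕ) (f : ℕ → ℕ) → m ≤ n → (∀ i → m ≤ i → f i ≡ 0) → ∑ (upTo n) f ≡ ∑ (upTo m) f
∑-upTo-truncate zero n f m≤n vanish = ∑-zero (upTo n) f (λ i → vanish i z≤n)
∑-upTo-truncate (suc m) (suc n) f (s≤s m≤n) vanish = trans (∑-upTo-suc n f)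
  (trans (cong (f 0 +_) (∑-upTo-truncate m n (f ∘ suc) m≤n (λ i m≤i → vanish (suc i) (s≤s m≤i))))
  (sym (∑-upTo-suc m f)))

∑-oneTo-guard : (t B : ℕ) (h : ℕ → ℕ) → t ≤ B →
  ∑ (oneTo B) (λ x → 𝟙 (x ≤? t) * h x) ≡ ∑ (oneTo t) (λ x → 𝟙 (x ≤? t) * h x)
∑-oneTo-guard t B h t≤B = trans (∑-map suc (upTo B) _)
  (trans (∑-upTo-truncate t B _ t≤B (λ i t≤i → cong (_* h (suc i)) (𝟙-no (suc i ≤? t) (<⇒≱ (s≤s t≤i)))))
  (sym (∑-map suc (upTo t) _)))

wordSum : ℕ → ℕ → ℕ → (List ℕ → ℕ) → ℕ
wordSum B j t K = ∑ (listsOfLength (oneTo B) j) (λ c → 𝟙 (sum c ≟ t) * K c)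

𝟙-sum-split : (x s t : ℕ) → 𝟙 (x + s ≟ t) ≡ 𝟙 (x ≤? t) * 𝟙 (s ≟ t ∸ x)
𝟙-sum-split x s t = trans (𝟙-⇔ (x + s ≟ t) ((x ≤? t) ×-dec (s ≟ t ∸ x)) to from) (𝟙-× (x ≤? t) (s ≟ t ∸ x))
  where
  to : x + s ≡ t → x ≤ t × s ≡ t ∸ x
  to refl = m≤m+n x s , sym (m+n∸m≡n x s)
  from : x ≤ t × s ≡ t ∸ x → x + s ≡ t
  from (x≤t , refl) = m+[n∸m]≡n x≤t

wordSum-suc : (B j t : ℕ) (K : List ℕ → ℕ) →
  wordSum B (suc j) t K ≡ ∑ (oneTo B) (λ x → 𝟙 (x ≤? t) * wordSum B j (t ∸ x) (K ∘ (x ∷_)))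
wordSum-suc B j t K =
  trans (∑-concatMap (λ x → map (x ∷_) (listsOfLength (oneTo B) j)) (oneTo B) _)
  (∑-cong (oneTo B) λ x →
    trans (∑-map (x ∷_) (listsOfLength (oneTo B) j) _)
    (trans (∑-cong (listsOfLength (oneTo B) j) (λ c →
             trans (cong (_* K (x ∷ c)) (𝟙-sum-split x (sum c) t)) (*-assoc (𝟙 (x ≤? t)) _ _)))
    (∑-*ˡ (listsOfLength (oneTo B) j) (𝟙 (x ≤? t)) _)))

-- positive letters: a word with more letters than its sum does not exist
wordSum-long : (B j t : ℕ) (K : List ℕ → ℕ) → t < j → wordSum B j t K ≡ 0
wordSum-long B (suc j) t K (s≤s t≤j) = trans (wordSum-suc B j t K)
  (trans (∑-map suc (upTo B) _) (∑-zero (upTo B) _ (λ i → vanish i (suc i ≤? t))))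
  where
  vanish : (i : ℕ) (d : Dec (suc i ≤ t)) → 𝟙 d * wordSum B j (t ∸ suc i) (K ∘ (suc i ∷_)) ≡ 0
  vanish i (yes i<t) = cong (1 *_) (wordSum-long B j (t ∸ suc i) _ (≤-trans (∸-monoʳ-< (s≤s z≤n) i<t) t≤j))
  vanish i (no _)    = refl

wordSum-alphabet : (B j t : ℕ) (K : List ℕ → ℕ) → t ≤ B → wordSum B j t K ≡ wordSum t j t K
wordSum-alphabet B zero t K t≤B = refl
wordSum-alphabet B (suc j) t K t≤B =
  trans (wordSum-suc B j t K)
  (trans (∑-cong (oneTo B) (λ x → 𝟙-guard (x ≤? t) (λ _ →
           trans (wordSum-alphabet B j (t ∸ x) _ (≤-trans (m∸n≤m t x) t≤B))
                 (sym (wordSum-alphabet t j (t ∸ x) _ (m∸n≤m t x))))))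
  (trans (∑-oneTo-guard t B _ t≤B) (sym (wordSum-suc t j t K))))

compositions-wordSum : (b : ℕ) (K : List ℕ → ℕ) → ∑ (compositions b) K ≡ ∑ (upTo (suc b)) (λ j → wordSum b j b K)
compositions-wordSum b K =
  trans (∑-filter (λ c → sum c ≟ b) (concatMap (listsOfLength (oneTo b)) (upTo (suc b))) K)
  (∑-concatMap (listsOfLength (oneTo b)) (upTo (suc b)) (λ c → 𝟙 (sum c ≟ b) * K c))

∑-compositions : (b : ℕ) (K : List ℕ → ℕ) →
  ∑ (compositions b) K ≡ 𝟙 (0 ≟ b) * K [] + ∑ (oneTo b) (λ v → ∑ (compositions (b ∸ v)) (K ∘ (v ∷_)))
∑-compositions b K =
  trans (compositions-wordSum b K)
  (trans (∑-upTo-suc b (λ j → wordSum b j b K))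
  (cong₂ _+_ (+-identityʳ _)
  (trans (∑-cong (upTo b) (λ j → wordSum-suc b j b K))
  (trans (∑-swap (upTo b) (oneTo b) _)
  (trans (∑-map suc (upTo b) _)
  (trans (∑-upTo-cong b first-part)
  (sym (∑-map suc (upTo b) _))))))))
  where
  first-part : ∀ i → i < b →
    ∑ (upTo b) (λ j → 𝟙 (suc i ≤? b) * wordSum b j (b ∸ suc i) (K ∘ (suc i ∷_)))
    ≡ ∑ (compositions (b ∸ suc i)) (K ∘ (suc i ∷_))
  first-part i i<b =
    trans (∑-cong (upTo b) (λ j → trans (cong (_* wordSum b j (b ∸ suc i) (K ∘ (suc i ∷_))) (𝟙-yes (suc i ≤? b) i<b))
            (trans (+-identityʳ _) (wordSum-alphabet b j (b ∸ suc i) _ (m∸n≤m b (suc i))))))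
    (trans (∑-upTo-truncate (suc (b ∸ suc i)) b _ (∸-monoʳ-< (s≤s z≤n) i<b)
             (λ j t<j → wordSum-long (b ∸ suc i) j (b ∸ suc i) _ t<j))
    (sym (compositions-wordSum (b ∸ suc i) (K ∘ (suc i ∷_)))))

occ : ℕ → List ℕ → ℕ
occ v xs = count (_≟ v) xs

remove : ℕ → List ℕ → List ℕ
remove v []       = []
remove v (x ∷ xs) = if does (x ≟ v) then xs else x ∷ remove v xs

occ-cons : (v x : ℕ) (xs : List ℕ) → occ v (x ∷ xs) ≡ 𝟙 (x ≟ v) + occ v xs
occ-cons v x xs = trans (count≡∑ (_≟ v) (x ∷ xs)) (cong (𝟙 (x ≟ v) +_) (sym (count≡∑ (_≟ v) xs)))

remove-head : {v x : ℕ} (xs : List ℕ) → x ≡ v → remove v (x ∷ xs) ≡ xs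
remove-head {v} {x} xs x≡v = cong (λ t → if t then xs else x ∷ remove v xs) (dec-true (x ≟ v) x≡v)

remove-tail : {v x : ℕ} (xs : List ℕ) → ¬ x ≡ v → remove v (x ∷ xs) ≡ x ∷ remove v xs
remove-tail {v} {x} xs x≢v = cong (λ t → if t then xs else x ∷ remove v xs) (dec-false (x ≟ v) x≢v)

occ-↭ : (v : ℕ) {xs ys : List ℕ} → xs ↭ ys → occ v xs ≡ occ v ys
occ-↭ v p = ↭-length (filter-↭ (_≟ v) p)

∈⇒occ : {v : ℕ} {xs : List ℕ} → v ∈ xs → 0 < occ v xs
∈⇒occ {v} {v ∷ xs} (here refl) =
  subst (0 <_) (sym (trans (occ-cons v v xs) (cong (_+ occ v xs) (𝟙-yes (v ≟ v) refl)))) (s≤s z≤n)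
∈⇒occ {v} {x ∷ xs} (there v∈xs) = subst (0 <_) (sym (occ-cons v x xs)) (≤-trans (∈⇒occ v∈xs) (m≤n+m _ _))

occ⇒∈ : {v : ℕ} (xs : List ℕ) → 0 < occ v xs → v ∈ xs
occ⇒∈ {v} (x ∷ xs) pos = split (x ≟ v) (subst (0 <_) (occ-cons v x xs) pos)
  where
  split : (d : Dec (x ≡ v)) → 0 < 𝟙 d + occ v xs → v ∈ x ∷ xs
  split (yes x≡v) _    = here (sym x≡v)
  split (no _)    pos′ = there (occ⇒∈ xs pos′)

remove-↭ : {v : ℕ} (xs : List ℕ) → v ∈ xs → xs ↭ v ∷ remove v xs
remove-↭ {v} (x ∷ xs) v∈ with x ≟ v | v∈
... | yes refl | _ rewrite remove-head {v} xs refl = ↭-refl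
... | no x≢v   | here v≡x = ⊥-elim (x≢v (sym v≡x))
... | no x≢v   | there v∈xs rewrite remove-tail {v} xs x≢v =
  ↭-trans (↭-prep x (remove-↭ xs v∈xs)) (↭.swap x v ↭-refl)

length-remove : (v : ℕ) (xs : List ℕ) → v ∈ xs → length xs ≡ suc (length (remove v xs))
length-remove v xs v∈ = ↭-length (remove-↭ xs v∈)

∈-remove : {v y : ℕ} (xs : List ℕ) → y ∈ remove v xs → y ∈ xs
∈-remove {v} (x ∷ xs) y∈ with x ≟ v
... | yes x≡v rewrite remove-head {v} xs x≡v = there y∈
... | no x≢v  rewrite remove-tail {v} xs x≢v with y∈
...   | here y≡x  = here y≡x
...   | there y∈′ = there (∈-remove xs y∈′)

occ-remove-same : (v : ℕ) (xs : List ℕ) → v ∈ xs → occ v xs ≡ suc (occ v (remove v xs))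
occ-remove-same v xs v∈ = trans (occ-↭ v (remove-↭ xs v∈))
  (trans (occ-cons v v (remove v xs)) (cong (_+ occ v (remove v xs)) (𝟙-yes (v ≟ v) refl)))

occ-remove-other : (v w : ℕ) (xs : List ℕ) → v ∈ xs → ¬ v ≡ w → occ w xs ≡ occ w (remove v xs)
occ-remove-other v w xs v∈ v≢w = trans (occ-↭ w (remove-↭ xs v∈))
  (trans (occ-cons w v (remove v xs)) (cong (_+ occ w (remove v xs)) (𝟙-no (v ≟ w) v≢w)))

Decreasing : List ℕ → Set
Decreasing = AllPairs _≥_

remove-Decreasing : {v : ℕ} (xs : List ℕ) → Decreasing xs → Decreasing (remove v xs)
remove-Decreasing         []       []         = []
remove-Decreasing {v} (x ∷ xs) (x≥ ∷ dec) with x ≟ v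
... | yes x≡v rewrite remove-head {v} xs x≡v = dec
... | no x≢v  rewrite remove-tail {v} xs x≢v =
  All.tabulate (λ y∈ → All.lookup x≥ (∈-remove xs y∈)) ∷ remove-Decreasing xs dec

≤-head : {v : ℕ} {xs : List ℕ} → Decreasing xs → v ∈ xs → v ≤ headOr0 xs
≤-head _         (here refl)  = ≤-refl
≤-head (x≥ ∷ _) (there v∈xs) = All.lookup x≥ v∈xs

Decreasing-↭-unique : {xs ys : List ℕ} → Decreasing xs → Decreasing ys → xs ↭ ys → xs ≡ ys
Decreasing-↭-unique {[]}     _ _ p = sym (↭-empty-inv (↭-sym p))
Decreasing-↭-unique {x ∷ xs} {[]} _ _ p with () ← ↭-empty-inv p
Decreasing-↭-unique {x ∷ xs} {y ∷ ys} dx dy p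
  with refl ← ≤-antisym (≤-head dy (Any-resp-↭ p (here refl))) (≤-head dx (Any-resp-↭ (↭-sym p) (here refl)))
  = cong (x ∷_) (Decreasing-↭-unique (AllPairs.tail dx) (AllPairs.tail dy) (drop-∷ p))

reverse-Decreasing : {xs : List ℕ} → AllPairs _≤_ xs → Decreasing (reverse xs)
reverse-Decreasing {[]}     []          = []
reverse-Decreasing {x ∷ xs} (x≤ ∷ incr) = subst Decreasing (sym (unfold-reverse x xs))
  (AllPairs.++⁺ (reverse-Decreasing incr) ([] ∷ [])
    (All-resp-↭ (↭-sym (↭-reverse xs)) (All.map (λ x≤y → x≤y ∷ []) x≤)))

sortDec-↭ : (α : List ℕ) → sortDec α ↭ α
sortDec-↭ α = ↭-trans (↭-reverse (sort α)) (sort-↭ α)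

sortDec-Decreasing : (α : List ℕ) → Decreasing (sortDec α)
sortDec-Decreasing α = reverse-Decreasing (Linked.Linked⇒AllPairs ≤-trans (sort-↗ α))

sortDec≡⇒↭ : (α : List ℕ) {λ′ : List ℕ} → sortDec α ≡ λ′ → α ↭ λ′
sortDec≡⇒↭ α refl = ↭-sym (sortDec-↭ α)

↭⇒sortDec≡ : (α : List ℕ) {λ′ : List ℕ} → Decreasing λ′ → α ↭ λ′ → sortDec α ≡ λ′
↭⇒sortDec≡ α dec p = Decreasing-↭-unique (sortDec-Decreasing α) dec (↭-trans (sortDec-↭ α) p)

∑-upTo-δ : (b y : ℕ) (K : ℕ → ℕ) → ∑ (upTo b) (λ i → 𝟙 (i ≟ y) * K i) ≡ 𝟙 (y <? b) * K y
∑-upTo-δ zero    y       K = refl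
∑-upTo-δ (suc b) zero    K = trans (∑-upTo-suc b (λ i → 𝟙 (i ≟ 0) * K i))
  (trans (cong (1 * K 0 +_) (∑-zero (upTo b) _ (λ _ → refl))) (+-identityʳ _))
∑-upTo-δ (suc b) (suc y) K = trans (∑-upTo-suc b (λ i → 𝟙 (i ≟ suc y) * K i)) (∑-upTo-δ b y (K ∘ suc))

∑-oneTo-δ : (b x : ℕ) → 1 ≤ x → (H : ℕ → ℕ) → ∑ (oneTo b) (λ v → 𝟙 (v ≟ x) * H v) ≡ 𝟙 (x ≤? b) * H x
∑-oneTo-δ b (suc x) _ H = trans (∑-map suc (upTo b) _) (∑-upTo-δ b x (H ∘ suc))

lowerings : List ℕ → List (ℕ × List ℕ)
lowerings []      = []
lowerings (b ∷ β) = map (λ v → v , (b ∸ v) ∷ β) (oneTo b) ++ map (map₂ (b ∷_)) (lowerings β)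

Represents : List ℕ → {k : ℕ} → (Fin k → ℕ) → Set
Represents []      {zero}  c = ⊤
Represents []      {suc k} c = ⊥
Represents (x ∷ β) {zero}  c = ⊥
Represents (x ∷ β) {suc k} c = x ≡ c fz × Represents β (c ∘ fs)

Represents-lookup : (β : List ℕ) → Represents β (lookup β)
Represents-lookup []      = tt
Represents-lookup (x ∷ β) = refl , Represents-lookup β

Represents⇒cast : (β : List ℕ) (c : Fin k → ℕ) → Represents β c →
  Σ (length β ≡ k) (λ e → ∀ i → lookup β i ≡ c (cast e i))
Represents⇒cast {zero} []      c tt = refl , λ ()
Represents⇒cast {suc k} (x ∷ β) c (x≡c0 , rep) with Represents⇒cast β (c ∘ fs) rep
... | e , β≗c = cong suc e , λ { fz → x≡c0 ; (fs i) → β≗c i }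

Rvec-Represents : (w β : List ℕ) (c : Fin k → ℕ) → Represents β c → Rvec w (lookup β) ≡ Rvec w c
Rvec-Represents w β c rep with Represents⇒cast β c rep
... | refl , β≗c = Rvec-cong w (λ i → trans (β≗c i) (cong c (FinP.cast-is-id refl i)))

_◂_ : ℕ → (Fin k → ℕ) → Fin (suc k) → ℕ
(b ◂ c) fz     = b
(b ◂ c) (fs i) = c i

-- summing over the entries j of β that can be lowered by x is summing over
-- the lowerings of β by x; stated for an arbitrary functional F of the
-- lowered vector, so that the induction on β can absorb the first entry into F
∑-lowerings : (x : ℕ) → 1 ≤ x → (β : List ℕ)
  (F : (Fin (length β) → ℕ) → ℕ) → (∀ c c′ → (∀ j → c j ≡ c′ j) → F c ≡ F c′) →
  (G : List ℕ → ℕ) → (∀ β′ c → Represents β′ c → G β′ ≡ F c) →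
  ∑ (allFin (length β)) (λ j → 𝟙 (x ≤? lookup β j) * F (decreaseAt (lookup β) j x))
  ≡ ∑ (lowerings β) (λ p → 𝟙 (proj₁ p ≟ x) * G (proj₂ p))
∑-lowerings x 1≤x []      F F-cong G G≡F = refl
∑-lowerings x 1≤x (b ∷ β) F F-cong G G≡F =
  trans (∑-allFin-suc (length β) _)
  (sym (trans (∑-++ (map (λ v → v , (b ∸ v) ∷ β) (oneTo b)) _ _) (cong₂ _+_
    (trans (∑-map (λ v → v , (b ∸ v) ∷ β) (oneTo b) _)
    (trans (∑-oneTo-δ b x 1≤x (λ v → G ((b ∸ v) ∷ β)))
           (cong (𝟙 (x ≤? b) *_) (G≡F _ _ (refl , Represents-lookup β)))))
    (trans (∑-map (map₂ (b ∷_)) (lowerings β) _)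
    (trans (sym (∑-lowerings x 1≤x β (F ∘ (b ◂_)) (λ c c′ c≗c′ → F-cong _ _ (λ { fz → refl ; (fs i) → c≗c′ i }))
                  (G ∘ (b ∷_)) (λ β′ c rep → G≡F (b ∷ β′) (b ◂ c) (refl , rep))))
    (∑-cong (allFin (length β)) (λ j → cong (𝟙 (x ≤? lookup β j) *_)
      (F-cong _ _ (λ { fz → refl ; (fs i) → refl })))))))))

R-remove : (λ′ : List ℕ) (v : ℕ) → v ∈ λ′ → 1 ≤ v → (β : List ℕ) →
  R λ′ β ≡ ∑ (lowerings β) (λ p → 𝟙 (proj₁ p ≟ v) * R (remove v λ′) (proj₂ p))
R-remove λ′ v v∈λ 1≤v β =
  trans (Rvec-perm (remove-↭ λ′ v∈λ) (lookup β))
  (trans (Rvec-cons v (remove v λ′) (lookup β))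
  (∑-lowerings v 1≤v β (Rvec (remove v λ′)) (λ c c′ → Rvec-cong (remove v λ′))
     (R (remove v λ′)) (Rvec-Represents (remove v λ′))))

∑-refinements-cons : (b : ℕ) (β : List ℕ) (H : List (List ℕ) → ℕ) →
  ∑ (refinements (b ∷ β)) H ≡ ∑ (compositions b) (λ c → ∑ (refinements β) (H ∘ (c ∷_)))
∑-refinements-cons b β H = trans (∑-concatMap (λ c → map (c ∷_) (refinements β)) (compositions b) H)
  (∑-cong (compositions b) (λ c → ∑-map (c ∷_) (refinements β) H))

popFirst : List ℕ → List (List ℕ) → List (ℕ × List (List ℕ))
popFirst []      bl = []
popFirst (v ∷ c) bl = (v , c ∷ bl) ∷ []

popHead : List (List ℕ) → List (ℕ × List (List ℕ))
popHead []       = []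
popHead (c ∷ bl) = popFirst c bl ++ map (map₂ (c ∷_)) (popHead bl)

∑-popHead-lengths : (bl : List (List ℕ)) (h : List ℕ → ℕ) →
  ∑ (popHead bl) (h ∘ map length ∘ proj₂) ≡ ∑ (decrements (map length bl)) h
∑-popHead-lengths []             h = refl
∑-popHead-lengths ([] ∷ bl)      h = trans (∑-map (map₂ ([] ∷_)) (popHead bl) _)
  (trans (∑-popHead-lengths bl (h ∘ (zero ∷_))) (sym (∑-map (zero ∷_) (decrements (map length bl)) h)))
∑-popHead-lengths ((v ∷ c) ∷ bl) h = cong (h (length c ∷ map length bl) +_)
  (trans (∑-map (map₂ ((v ∷ c) ∷_)) (popHead bl) _)
  (trans (∑-popHead-lengths bl (h ∘ (suc (length c) ∷_))) (sym (∑-map (suc (length c) ∷_) (decrements (map length bl)) h))))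

-- Pascal's rule on blocks: the first element of an ordered set partition
-- is the first part of one of the blocks
multinomial-popHead : (bl : List (List ℕ)) (n : ℕ) → sum (map length bl) ≡ suc n →
  multinomial (suc n) (map length bl) ≡ ∑ (popHead bl) (multinomial n ∘ map length ∘ proj₂)
multinomial-popHead bl n e = trans (multinomial-pascal (map length bl) n e) (sym (∑-popHead-lengths bl (multinomial n)))

popHead-↭ : (bl : List (List ℕ)) → All (λ p → concat bl ↭ proj₁ p ∷ concat (proj₂ p)) (popHead bl)
popHead-↭ []       = []
popHead-↭ (c ∷ bl) = All.++⁺ (first c) (All.map⁺ (All.map (λ {p} → rest {p}) (popHead-↭ bl)))
  where
  first : (c : List ℕ) → All (λ p → concat (c ∷ bl) ↭ proj₁ p ∷ concat (proj₂ p)) (popFirst c bl)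
  first []      = []
  first (v ∷ c) = ↭-refl ∷ []
  rest : {p : ℕ × List (List ℕ)} → concat bl ↭ proj₁ p ∷ concat (proj₂ p) →
    c ++ concat bl ↭ proj₁ p ∷ c ++ concat (proj₂ p)
  rest {v , bl′} π = ↭-trans (++⁺ˡ c π) (shift v c (concat bl′))

∑-refinements-popHead : (β : List ℕ) (G : ℕ → List (List ℕ) → ℕ) →
  ∑ (refinements β) (λ bl → ∑ (popHead bl) (λ p → G (proj₁ p) (proj₂ p)))
  ≡ ∑ (lowerings β) (λ p → ∑ (refinements (proj₂ p)) (G (proj₁ p)))
∑-refinements-popHead []      G = refl
∑-refinements-popHead (b ∷ β) G =
  trans (∑-refinements-cons b β _)
  (trans (∑-cong (compositions b) (λ c → trans
           (∑-cong (refinements β) (λ r → trans (∑-++ (popFirst c r) _ _)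
             (cong (∑ (popFirst c r) G′ +_) (∑-map (map₂ (c ∷_)) (popHead r) G′))))
           (∑-+ (refinements β) _ _)))
  (trans (∑-+ (compositions b) _ _)
  (trans (cong₂ _+_ pop-β₁ pop-later)
  (sym (∑-++ (map (λ v → v , (b ∸ v) ∷ β) (oneTo b)) _ _)))))
  where
  G′ : ℕ × List (List ℕ) → ℕ
  G′ p = G (proj₁ p) (proj₂ p)
  F : ℕ × List ℕ → ℕ
  F p = ∑ (refinements (proj₂ p)) (G (proj₁ p))
  -- the popped part is the first part v of the first block (a composition of b)
  pop-β₁ : ∑ (compositions b) (λ c → ∑ (refinements β) (λ r → ∑ (popFirst c r) G′))
           ≡ ∑ (map (λ v → v , (b ∸ v) ∷ β) (oneTo b)) F
  pop-β₁ = trans (∑-compositions b _)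
    (trans (cong₂ _+_ (trans (cong (𝟙 (0 ≟ b) *_) (∑-zero (refinements β) _ (λ _ → refl))) (*-zeroʳ (𝟙 (0 ≟ b)))) refl)
    (sym (trans (∑-map (λ v → v , (b ∸ v) ∷ β) (oneTo b) F)
      (∑-cong (oneTo b) (λ v → trans (∑-refinements-cons (b ∸ v) β (G v))
        (∑-cong (compositions (b ∸ v)) (λ c → ∑-cong (refinements β) (λ r → sym (+-identityʳ _)))))))))
  -- the popped part lies in a later block
  pop-later : ∑ (compositions b) (λ c → ∑ (refinements β) (λ r → ∑ (popHead r) (λ p → G (proj₁ p) (c ∷ proj₂ p))))
              ≡ ∑ (map (map₂ (b ∷_)) (lowerings β)) F
  pop-later = trans (∑-cong (compositions b) (λ c → ∑-refinements-popHead β (λ v r → G v (c ∷ r))))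
    (trans (∑-swap (compositions b) (lowerings β) (λ c p → ∑ (refinements (proj₂ p)) (λ r → G (proj₁ p) (c ∷ r))))
    (sym (trans (∑-map (map₂ (b ∷_)) (lowerings β) F)
      (∑-cong (lowerings β) (λ p → ∑-refinements-cons b (proj₂ p) (G (proj₁ p)))))))

Arranges? : (bl : List (List ℕ)) (λ′ : List ℕ) → Dec (sortDec (concat bl) ≡ λ′)
Arranges? bl λ′ = ≡-dec _≟_ (sortDec (concat bl)) λ′

rhs-closed : (λ′ β : List ℕ) →
  rhs λ′ β ≡ ∑ (refinements β) (λ bl → 𝟙 (Arranges? bl λ′) * multinomial (length λ′) (map length bl))
rhs-closed λ′ β = trans (∑-filter (λ bl → Arranges? bl λ′) (refinements β) OSPcount)
  (∑-cong (refinements β) (λ bl → 𝟙-guard (Arranges? bl λ′) (λ α̃≡λ →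
    trans (OSPcount-closed bl) (cong (λ n → multinomial n (map length bl)) (↭-length (sortDec≡⇒↭ (concat bl) α̃≡λ))))))

arrangement-cons : {v : ℕ} {α α′ λ′ : List ℕ} → Decreasing λ′ → α ↭ v ∷ α′ →
  sortDec α ≡ λ′ → v ∈ λ′ × sortDec α′ ≡ remove v λ′
arrangement-cons {v} {α} {α′} {λ′} dec π α̃≡λ = v∈λ
  , ↭⇒sortDec≡ α′ (remove-Decreasing λ′ dec) (drop-∷ (↭-trans (↭-sym π) (↭-trans α↭λ (remove-↭ λ′ v∈λ))))
  where
  α↭λ : α ↭ λ′
  α↭λ = sortDec≡⇒↭ α α̃≡λ
  v∈λ : v ∈ λ′
  v∈λ = Any-resp-↭ (↭-trans (↭-sym π) α↭λ) (here refl)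

arrangement-cons⁻ : {v : ℕ} {α α′ λ′ : List ℕ} → Decreasing λ′ → α ↭ v ∷ α′ →
  v ∈ λ′ × sortDec α′ ≡ remove v λ′ → sortDec α ≡ λ′
arrangement-cons⁻ {v} {α} {α′} {λ′} dec π (v∈λ , α̃′≡λ-v) =
  ↭⇒sortDec≡ α dec (↭-trans π (↭-trans (↭-prep v (sortDec≡⇒↭ α′ α̃′≡λ-v)) (↭-sym (remove-↭ λ′ v∈λ))))

-- rhs-recursion: the first element of an ordered set partition in OSP(α,β) is
-- the first part v of some block; removing it lowers that entry of β by v
-- and removes the part v from λ
rhs-remove : (λ′ : List ℕ) (N : ℕ) → Decreasing λ′ → length λ′ ≡ suc N → (β : List ℕ) →
  rhs λ′ β ≡ ∑ (lowerings β) (λ p → 𝟙 (proj₁ p ∈? λ′) * rhs (remove (proj₁ p) λ′) (proj₂ p))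
rhs-remove λ′ N dec len β =
  trans (rhs-closed λ′ β)
  (trans (∑-cong (refinements β) pop)
  (trans (∑-refinements-popHead β T)
  (∑-cong (lowerings β) (λ p → trans (∑-*ˡ (refinements (proj₂ p)) (𝟙 (proj₁ p ∈? λ′)) _)
    (𝟙-guard (proj₁ p ∈? λ′) (λ v∈λ → sym (rest (proj₁ p) v∈λ (proj₂ p))))))))
  where
  T : ℕ → List (List ℕ) → ℕ
  T v bl′ = 𝟙 (v ∈? λ′) * (𝟙 (Arranges? bl′ (remove v λ′)) * multinomial N (map length bl′))
  pop : (bl : List (List ℕ)) →
    𝟙 (Arranges? bl λ′) * multinomial (length λ′) (map length bl) ≡ ∑ (popHead bl) (λ p → T (proj₁ p) (proj₂ p))
  pop bl =
    trans (𝟙-guard (Arranges? bl λ′) (λ α̃≡λ → trans (cong (λ n → multinomial n (map length bl)) len)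
            (multinomial-popHead bl N (trans (sum-lengths bl) (trans (↭-length (sortDec≡⇒↭ (concat bl) α̃≡λ)) len)))))
    (trans (sym (∑-*ˡ (popHead bl) (𝟙 (Arranges? bl λ′)) _))
    (∑-cong-All (popHead bl) (popHead-↭ bl) λ { (v , bl′) π →
      trans (cong (_* multinomial N (map length bl′))
        (trans (𝟙-⇔ (Arranges? bl λ′) ((v ∈? λ′) ×-dec Arranges? bl′ (remove v λ′))
                    (arrangement-cons dec π) (arrangement-cons⁻ dec π))
               (𝟙-× (v ∈? λ′) (Arranges? bl′ (remove v λ′)))))
      (*-assoc (𝟙 (v ∈? λ′)) _ _) }))
  rest : (v : ℕ) → v ∈ λ′ → (β′ : List ℕ) →
    rhs (remove v λ′) β′
    ≡ ∑ (refinements β′) (λ bl′ → 𝟙 (Arranges? bl′ (remove v λ′)) * multinomial N (map length bl′))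
  rest v v∈λ β′ = trans (rhs-closed (remove v λ′) β′) (∑-cong (refinements β′) (λ bl′ →
    cong (λ n → 𝟙 (Arranges? bl′ (remove v λ′)) * multinomial n (map length bl′))
         (suc-injective (trans (sym (length-remove v λ′ v∈λ)) len))))

allZero? : (β : List ℕ) → Dec (∀ j → lookup β j ≡ 0)
allZero? β = FinP.all? (λ j → lookup β j ≟ 0)

𝟙-allZero-cons : (b : ℕ) (β : List ℕ) → 𝟙 (allZero? (b ∷ β)) ≡ 𝟙 (0 ≟ b) * 𝟙 (allZero? β)
𝟙-allZero-cons b β = trans (𝟙-⇔ (allZero? (b ∷ β)) ((0 ≟ b) ×-dec allZero? β)
    (λ h → sym (h fz) , h ∘ fs) (λ { (0≡b , h) fz → sym 0≡b ; (0≡b , h) (fs j) → h j }))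
  (𝟙-× (0 ≟ b) (allZero? β))

R-nil : (β : List ℕ) → R [] β ≡ 𝟙 (allZero? β)
R-nil β = fibreCount-nil (lookup []) (lookup β)

rhs-nil : (β : List ℕ) → rhs [] β ≡ 𝟙 (allZero? β)
rhs-nil β = trans (rhs-closed [] β) (no-parts β)
  where
  F : List (List ℕ) → ℕ
  F bl = 𝟙 (Arranges? bl []) * multinomial 0 (map length bl)
  no-parts : (β : List ℕ) → ∑ (refinements β) F ≡ 𝟙 (allZero? β)
  no-parts []      = cong (λ n → n * 1 + 0) (𝟙-yes (Arranges? [] []) (↭⇒sortDec≡ [] [] ↭-refl))
  no-parts (b ∷ β) =
    trans (∑-refinements-cons b β F)
    (trans (∑-compositions b _)
    (trans (cong₂ _+_
      (cong (𝟙 (0 ≟ b) *_) (trans (∑-cong (refinements β) (λ r → cong (𝟙 (Arranges? r []) *_) (+-identityʳ _))) (no-parts β)))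
      (∑-zero (oneTo b) _ (λ v → ∑-zero (compositions (b ∸ v)) _ (λ c → ∑-zero (refinements β) _ (λ r →
        cong (_* multinomial 0 (map length ((v ∷ c) ∷ r)))
          (𝟙-no (Arranges? ((v ∷ c) ∷ r) [])
                (λ α̃≡[] → nonempty (↭-length (sortDec≡⇒↭ (concat ((v ∷ c) ∷ r)) α̃≡[])))))))))
    (trans (+-identityʳ _) (sym (𝟙-allZero-cons b β)))))
    where
    nonempty : {n : ℕ} → ¬ suc n ≡ 0
    nonempty ()

multL : List ℕ → ℕ
multL λ′ = multinomial (length λ′) (multiplicities λ′)

applyUpTo-tabulate : (n : ℕ) (f : ℕ → ℕ) → applyUpTo f n ≡ tabulate {n = n} (f ∘ toℕ)
applyUpTo-tabulate zero    f = refl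
applyUpTo-tabulate (suc n) f = cong (f 0 ∷_) (applyUpTo-tabulate n (f ∘ suc))

multiplicities-tabulate : (λ′ : List ℕ) → multiplicities λ′ ≡ tabulate (λ (j : Fin (headOr0 λ′)) → occ (suc (toℕ j)) λ′)
multiplicities-tabulate λ′ =
  trans (map-upTo (λ i → occ (suc i) λ′) (headOr0 λ′)) (applyUpTo-tabulate (headOr0 λ′) (λ i → occ (suc i) λ′))

multinomial-trailing-zeros : (n B B′ : ℕ) (g : ℕ → ℕ) → B′ ≤ B → (∀ i → B′ ≤ i → g i ≡ 0) →
  multinomial n (tabulate {n = B} (g ∘ toℕ)) ≡ multinomial n (tabulate {n = B′} (g ∘ toℕ))
multinomial-trailing-zeros n zero    zero     g _ _ = refl
multinomial-trailing-zeros n (suc B) zero     g _ vanish rewrite vanish 0 z≤n =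
  trans (+-identityʳ _) (multinomial-trailing-zeros n B zero (g ∘ suc) z≤n (λ i _ → vanish (suc i) z≤n))
multinomial-trailing-zeros n (suc B) (suc B′) g (s≤s B′≤B) vanish =
  cong ((n C g 0) *_) (multinomial-trailing-zeros (n ∸ g 0) B B′ (g ∘ suc) B′≤B (λ i B′≤i → vanish (suc i) (s≤s B′≤i)))

𝟙-≟-sym : (x y : ℕ) → 𝟙 (x ≟ y) ≡ 𝟙 (y ≟ x)
𝟙-≟-sym x y = 𝟙-⇔ (x ≟ y) (y ≟ x) sym sym

sum-multiplicities : (B : ℕ) (λ′ : List ℕ) → All (λ x → 1 ≤ x × x ≤ B) λ′ →
  ∑ (upTo B) (λ i → occ (suc i) λ′) ≡ length λ′
sum-multiplicities B []           []                = ∑-zero (upTo B) _ (λ _ → refl)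
sum-multiplicities B (suc x ∷ xs) ((_ , x<B) ∷ bds) =
  trans (∑-cong (upTo B) (λ i → occ-cons (suc i) (suc x) xs))
  (trans (∑-+ (upTo B) _ _)
  (cong₂ _+_
    (trans (∑-cong (upTo B) (λ i → trans (𝟙-≟-sym x i) (sym (*-identityʳ _))))
    (trans (∑-upTo-δ B x (λ _ → 1)) (cong (_* 1) (𝟙-yes (x <? B) x<B))))
    (sum-multiplicities B xs bds)))

headOr0-≤ : {m : ℕ} (xs : List ℕ) → (∀ {y} → y ∈ xs → y ≤ m) → headOr0 xs ≤ m
headOr0-≤ []      bound = z≤n
headOr0-≤ (x ∷ _) bound = bound (here refl)

multiplicities-remove : (λ′ : List ℕ) (N : ℕ) → Decreasing λ′ → length λ′ ≡ suc N →
  (j : Fin (headOr0 λ′)) → suc (toℕ j) ∈ λ′ →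
  multinomial N (tabulate (decreaseAt (λ i → occ (suc (toℕ i)) λ′) j 1)) ≡ multL (remove (suc (toℕ j)) λ′)
multiplicities-remove λ′ N dec len j v∈λ =
  trans (cong (multinomial N) (tabulate-cong lowered))
  (trans (multinomial-trailing-zeros N (headOr0 λ′) B′ g B′≤B vanish)
  (sym (cong₂ multinomial (suc-injective (trans (sym (length-remove v λ′ v∈λ)) len)) (multiplicities-tabulate (remove v λ′)))))
  where
  v : ℕ
  v = suc (toℕ j)
  B′ : ℕ
  B′ = headOr0 (remove v λ′)
  g : ℕ → ℕ
  g w = occ (suc w) (remove v λ′)
  lowered : ∀ i → decreaseAt (λ i → occ (suc (toℕ i)) λ′) j 1 i ≡ g (toℕ i)
  lowered i with j FinP.≟ i
  ... | yes refl = cong (_∸ 1) (occ-remove-same v λ′ v∈λ)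
  ... | no j≢i   = occ-remove-other v (suc (toℕ i)) λ′ v∈λ (j≢i ∘ FinP.toℕ-injective ∘ suc-injective)
  B′≤B : B′ ≤ headOr0 λ′
  B′≤B = headOr0-≤ (remove v λ′) (λ y∈ → ≤-head dec (∈-remove λ′ y∈))
  vanish : ∀ w → B′ ≤ w → g w ≡ 0
  vanish w B′≤w = n≤0⇒n≡0 (≮⇒≥ (λ pos →
    <⇒≱ (s≤s B′≤w) (≤-head (remove-Decreasing λ′ dec) (occ⇒∈ (remove v λ′) pos))))

∑-allFin-toℕ : (n : ℕ) (f : ℕ → ℕ) → ∑ (allFin n) (f ∘ toℕ) ≡ ∑ (upTo n) f
∑-allFin-toℕ zero    f = refl
∑-allFin-toℕ (suc n) f = trans (∑-allFin-suc n (f ∘ toℕ))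
  (trans (cong (f 0 +_) (∑-allFin-toℕ n (f ∘ suc))) (sym (∑-upTo-suc n f)))

-- Pascal's rule for multL: the first part of an arrangement of λ is one of its values v
multL-remove : (λ′ : List ℕ) (N : ℕ) → All (1 ≤_) λ′ → Decreasing λ′ → length λ′ ≡ suc N →
  multL λ′ ≡ ∑ (oneTo (headOr0 λ′)) (λ v → 𝟙 (v ∈? λ′) * multL (remove v λ′))
multL-remove λ′ N pos dec len = begin
  multL λ′
    ≡⟨ cong₂ multinomial len (multiplicities-tabulate λ′) ⟩
  multinomial (suc N) (tabulate m)
    ≡⟨ multinomial-pascal (tabulate m) N
         (trans (cong sum (sym (multiplicities-tabulate λ′))) (trans (sum-multiplicities λ₁ λ′ bounds) len)) ⟩
  ∑ (decrements (tabulate m)) (multinomial N)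
    ≡⟨ ∑-decrements-tabulate m (multinomial N) ⟩
  ∑ (allFin λ₁) (λ j → 𝟙 (1 ≤? m j) * multinomial N (tabulate (decreaseAt m j 1)))
    ≡⟨ ∑-cong (allFin λ₁) (λ j → 𝟙-guard (1 ≤? m j) (λ pos-m →
         multiplicities-remove λ′ N dec len j (occ⇒∈ λ′ pos-m))) ⟩
  ∑ (allFin λ₁) (λ j → 𝟙 (1 ≤? m j) * multL (remove (suc (toℕ j)) λ′))
    ≡⟨ ∑-allFin-toℕ λ₁ (λ i → 𝟙 (1 ≤? occ (suc i) λ′) * multL (remove (suc i) λ′)) ⟩
  ∑ (upTo λ₁) (λ i → 𝟙 (1 ≤? occ (suc i) λ′) * multL (remove (suc i) λ′))
    ≡⟨ sym (∑-map suc (upTo λ₁) _) ⟩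
  ∑ (oneTo λ₁) (λ v → 𝟙 (1 ≤? occ v λ′) * multL (remove v λ′))
    ≡⟨ ∑-cong (oneTo λ₁) (λ v → cong (_* multL (remove v λ′))
         (𝟙-⇔ (1 ≤? occ v λ′) (v ∈? λ′) (occ⇒∈ λ′) ∈⇒occ)) ⟩
  ∑ (oneTo λ₁) (λ v → 𝟙 (v ∈? λ′) * multL (remove v λ′)) ∎
  where
  open ≡-Reasoning
  λ₁ : ℕ
  λ₁ = headOr0 λ′
  m : Fin λ₁ → ℕ
  m j = occ (suc (toℕ j)) λ′
  bounds : All (λ x → 1 ≤ x × x ≤ λ₁) λ′
  bounds = All.tabulate (λ x∈ → All.lookup pos x∈ , ≤-head dec x∈)

∑-parts-δ : (λ′ : List ℕ) → All (1 ≤_) λ′ → Decreasing λ′ → (u : ℕ) (Z : ℕ → ℕ) →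
  ∑ (oneTo (headOr0 λ′)) (λ v → 𝟙 (v ∈? λ′) * (𝟙 (u ≟ v) * Z v)) ≡ 𝟙 (u ∈? λ′) * Z u
∑-parts-δ λ′ pos dec u Z =
  trans (∑-cong (oneTo λ₁) (λ v → trans (*-left-comm (𝟙 (v ∈? λ′)) (𝟙 (u ≟ v)) (Z v)) (cong (_* _) (𝟙-≟-sym u v))))
  (picks u)
  where
  λ₁ : ℕ
  λ₁ = headOr0 λ′
  picks : (u : ℕ) → ∑ (oneTo λ₁) (λ v → 𝟙 (v ≟ u) * (𝟙 (v ∈? λ′) * Z v)) ≡ 𝟙 (u ∈? λ′) * Z u
  picks zero = trans (∑-map suc (upTo λ₁) _) (trans (∑-zero (upTo λ₁) _ (λ _ → refl))
    (sym (cong (_* Z 0) (𝟙-no (0 ∈? λ′) (λ 0∈λ → 1≰0 (All.lookup pos 0∈λ))))))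
    where
    1≰0 : ¬ 1 ≤ 0
    1≰0 ()
  picks (suc y) = trans (∑-oneTo-δ λ₁ (suc y) (s≤s z≤n) _) (fits (suc y ∈? λ′))
    where
    fits : (d : Dec (suc y ∈ λ′)) → 𝟙 (suc y ≤? λ₁) * (𝟙 d * Z (suc y)) ≡ 𝟙 d * Z (suc y)
    fits (yes y∈λ) = trans (cong (_* _) (𝟙-yes (suc y ≤? λ₁) (≤-head dec y∈λ))) (+-identityʳ _)
    fits (no _)    = *-zeroʳ (𝟙 (suc y ≤? λ₁))

multL*R≡rhs : (N : ℕ) (λ′ : List ℕ) → length λ′ ≡ N → All (1 ≤_) λ′ → Decreasing λ′ →
  (β : List ℕ) → multL λ′ * R λ′ β ≡ rhs λ′ β
multL*R≡rhs zero    []  _   _   _   β = trans (+-identityʳ (R [] β)) (trans (R-nil β) (sym (rhs-nil β)))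
multL*R≡rhs (suc N) λ′ len pos dec β = begin
  multL λ′ * R λ′ β
    ≡⟨ cong (_* R λ′ β) (multL-remove λ′ N pos dec len) ⟩
  ∑ (oneTo λ₁) (λ v → 𝟙 (v ∈? λ′) * multL (remove v λ′)) * R λ′ β
    ≡⟨ ∑-*ʳ (oneTo λ₁) (R λ′ β) _ ⟩
  ∑ (oneTo λ₁) (λ v → 𝟙 (v ∈? λ′) * multL (remove v λ′) * R λ′ β)
    ≡⟨ ∑-cong (oneTo λ₁) (λ v → trans (*-assoc (𝟙 (v ∈? λ′)) _ _) (𝟙-guard (v ∈? λ′) (remove-part v))) ⟩
  ∑ (oneTo λ₁) (λ v → 𝟙 (v ∈? λ′) * ∑ (lowerings β) (λ p → 𝟙 (proj₁ p ≟ v) * rhs (remove v λ′) (proj₂ p)))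
    ≡⟨ ∑-cong (oneTo λ₁) (λ v → sym (∑-*ˡ (lowerings β) (𝟙 (v ∈? λ′)) _)) ⟩
  ∑ (oneTo λ₁) (λ v → ∑ (lowerings β) (λ p → 𝟙 (v ∈? λ′) * (𝟙 (proj₁ p ≟ v) * rhs (remove v λ′) (proj₂ p))))
    ≡⟨ ∑-swap (oneTo λ₁) (lowerings β) _ ⟩
  ∑ (lowerings β) (λ p → ∑ (oneTo λ₁) (λ v → 𝟙 (v ∈? λ′) * (𝟙 (proj₁ p ≟ v) * rhs (remove v λ′) (proj₂ p))))
    ≡⟨ ∑-cong (lowerings β) (λ p → ∑-parts-δ λ′ pos dec (proj₁ p) (λ v → rhs (remove v λ′) (proj₂ p))) ⟩
  ∑ (lowerings β) (λ p → 𝟙 (proj₁ p ∈? λ′) * rhs (remove (proj₁ p) λ′) (proj₂ p))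
    ≡⟨ rhs-remove λ′ N dec len β ⟨
  rhs λ′ β ∎
  where
  open ≡-Reasoning
  λ₁ : ℕ
  λ₁ = headOr0 λ′
  remove-part : (v : ℕ) → v ∈ λ′ →
    multL (remove v λ′) * R λ′ β ≡ ∑ (lowerings β) (λ p → 𝟙 (proj₁ p ≟ v) * rhs (remove v λ′) (proj₂ p))
  remove-part v v∈λ =
    trans (cong (multL λ-v *_) (R-remove λ′ v v∈λ (All.lookup pos v∈λ) β))
    (trans (sym (∑-*ˡ (lowerings β) (multL λ-v) _))
    (∑-cong (lowerings β) (λ p → trans (*-left-comm (multL λ-v) (𝟙 (proj₁ p ≟ v)) _)
      (cong (𝟙 (proj₁ p ≟ v) *_) (multL*R≡rhs N λ-v len-v pos-v (remove-Decreasing λ′ dec) (proj₂ p))))))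
    where
    λ-v : List ℕ
    λ-v = remove v λ′
    len-v : length λ-v ≡ N
    len-v = suc-injective (trans (sym (length-remove v λ′ v∈λ)) len)
    pos-v : All (1 ≤_) λ-v
    pos-v = All.tail (All-resp-↭ (remove-↭ λ′ v∈λ) pos)

lemma3p23 : (n : ℕ) (λ′ β : List ℕ) → IsPartition n λ′ → IsComposition n β →
    multinomial (length λ′) (multiplicities λ′) * R λ′ β ≡ rhs λ′ β
lemma3p23 n λ′ β (positive , decreasing , _) _ =
  multL*R≡rhs (length λ′) λ′ refl positive (Linked.Linked⇒AllPairs (λ x≥y y≥z → ≤-trans y≥z x≥y) decreasing) β
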